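{- Let $m,k$ be positive integers. If a graph $G$ realizes $(1,m,k,1)$, then the subgraph of $G$ induced by the vertices of corner rank $3$ is connected.
   Context: All graphs are finite, nonempty, simple and reflexive. Corner ranking: $N[v]$ is the closed neighborhood. In a graph $H$, $w$ strictly corners a distinct vertex $v$ if $N[v]\subsetneq N[w]$. Set $G^{(1)}=G$, $k=1$. If $G^{(k)}$ is a clique, give its vertices rank $k$ and stop; else if it has no strict corners, give its vertices rank $\infty$ and stop; else give all strict corners of $G^{(k)}$ rank $k$, delete them to get $G^{(k+1)}$, increase $k$, repeat. The corner rank $\alpha$ is the largest vertex rank; cop-win graphs are exactly those with finite corner rank. The rank cardinality vector of $G$ is $(x_\alpha,\ldots,x_1)$, $x_k$ being the number of vertices of rank $k$; a cop-win graph realizes its rank cardinality vector. -}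

module Defs where

open import Data.Nat using (ℕ; zero; suc; _<_; _≤_; _∸_)
open import Data.Nat.Base using (_≡ᵇ_)
open import Data.Bool using (Bool; true; false; _∧_; _∨_; not; if_then_else_)
open import Data.Fin using (Fin; toℕ)
open import Data.List using (List; allFin; filter; length)
open import Data.Bool.ListAction using (all; any)
open import Data.Vec using (Vec; lookup)
open import Data.Product using (Σ; ∃; _×_; _,_)
open import Relation.Binary.PropositionalEquality using (_≡_)
open import Relation.Nullary.Decidable using (Dec)
open import Data.Bool.Properties using () renaming (_≟_ to _≟ᵇ_)

record Graph : Set where
  field
    n        : ℕ
    nonempty : 0 < n
    adj      : Fin n → Fin n → Bool
    adj-refl : ∀ v → adj v v ≡ true
    adj-sym  : ∀ u v → adj u v ≡ adj v u
open Graph public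

allV : ∀ {n} → (Fin n → Bool) → Bool
allV {n} p = all p (allFin n)

anyV : ∀ {n} → (Fin n → Bool) → Bool
anyV {n} p = any p (allFin n)

_⇒ᵇ_ : Bool → Bool → Bool
a ⇒ᵇ b = not a ∨ b

-- A vertex subset (the current graph G^(k) is the subgraph induced by S)
VSet : ℕ → Set
VSet n = Fin n → Bool

module _ (G : Graph) where
  private
    V = Fin (n G)
    A = adj G

  nbhdSub : VSet (n G) → V → V → Bool
  nbhdSub S v w = allV (λ u → (S u ∧ A u v) ⇒ᵇ A u w)

  strictlyCorners : VSet (n G) → V → V → Bool
  strictlyCorners S w v = S v ∧ S w ∧ nbhdSub S v w ∧ not (nbhdSub S w v)

  isStrictCorner : VSet (n G) → V → Bool
  isStrictCorner S v = anyV (λ w → strictlyCorners S w v)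

  hasStrictCorner : VSet (n G) → Bool
  hasStrictCorner S = anyV (isStrictCorner S)

  isClique : VSet (n G) → Bool
  isClique S = allV (λ u → allV (λ v → (S u ∧ S v) ⇒ᵇ A u v))

data Rank : Set where
  fin : ℕ → Rank
  ∞   : Rank

module _ (G : Graph) where
  private
    V = Fin (n G)

  -- The corner ranking procedure, run on G^(k) = G[S] with fuel.
  -- Only called on vertices v ∈ S (vertices not yet ranked).
  rankGo : ℕ → ℕ → VSet (n G) → V → Rank
  rankGo zero    k S v = ∞   -- never reached with sufficient fuel
  rankGo (suc f) k S v =
    if isClique G S then fin k
    else if not (hasStrictCorner G S) then ∞
    else if isStrictCorner G S v then fin k
    else rankGo f (suc k) (λ u → S u ∧ not (isStrictCorner G S u)) v

  -- Each non-terminal round deletes at least one vertex and keeps a nonempty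
  -- set, so n rounds (fuel suc n) suffice.
  rank : V → Rank
  rank v = rankGo (suc (n G)) 1 (λ _ → true) v

  hasRank : ℕ → V → Bool
  hasRank r v with rank v
  ... | fin s = r ≡ᵇ s
  ... | ∞     = false

  rankCount : ℕ → ℕ
  rankCount r = length (filter (λ v → hasRank r v ≟ᵇ true) (allFin (n G)))

  -- corner rank α = largest vertex rank (finite: cop-win)
  CornerRank : ℕ → Set
  CornerRank α = (∀ v → Σ ℕ (λ r → rank v ≡ fin r × r ≤ α)) × ∃ (λ v → rank v ≡ fin α)

  -- G realizes (x_α, …, x_1): G is cop-win with corner rank α and x_r
  -- vertices of rank r.  Entry i (0-based) of the vector is x_{α-i}.
  Realizes : ∀ {α} → Vec ℕ α → Set
  Realizes {α} xs = CornerRank α × (∀ (i : Fin α) → rankCount (α ∸ toℕ i) ≡ lookup xs i)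

  data Walk (P : V → Set) : V → V → Set where
    here : ∀ {u} → P u → Walk P u u
    step : ∀ {u w v} → P u → adj G u w ≡ true → Walk P w v → Walk P u v

  InducedConnected : (V → Set) → Set
  InducedConnected P = ∀ u v → P u → P v → Walk P u v

module Submission where

-- Write S₀ = V(G) and S_{i+1} = S_i minus the strict corners of G[S_i], so
-- that (as long as the procedure runs) the vertices of rank i+1 are exactly
-- S_i ∖ S_{i+1}.  The heart of the proof (module FourLayers) is a statement
-- about four consecutive layers S₀ ⊇ S₁ ⊇ S₂ ⊇ S₃, with S₀ arbitrary: if the
-- first round removes a single vertex x and S₃ has at most one vertex, then
-- S₂ ∖ S₃ induces a connected subgraph of diameter at most 4.
--   (1) every vertex removed in the second round is adjacent to x;
--   (2) so a survivor u of G[S₁] dominating a vertex w that corners x sees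
--       all of them (the hub);
--   (3) every b ∈ S₂ ∖ S₃ and the hub have a common neighbour in S₂ ∖ S₃,
--       found by following dominations from b up one layer and back.
-- It rests on two general facts (module Domination): every vertex of G[S] is
-- dominated by a non-corner, since strict domination enlarges the closed
-- neighbourhood; and a survivor strictly dominated in the next layer sees a
-- removed corner that its dominator misses.  Module Ranking unfolds the
-- ranking procedure round by round to identify ranks with layers, and the
-- counts x₁ = x₄ = 1 supply the hypotheses on x and S₃.

open import Defs
open import Data.Bool using (Bool; true; false; _∧_; not)
open import Data.Bool.Properties using (∧-conicalˡ; ∧-conicalʳ; ∧-zeroʳ; T-≡; ¬-not)
  renaming (_≟_ to _≟ᵇ_)
open import Data.Empty using (⊥; ⊥-elim)
open import Data.Fin using (Fin; zero; suc)
open import Data.Fin.Properties using (¬∀⟶∃¬)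
open import Data.Fin.Subset using (Subset; ∣_∣; _⊂_) renaming (_∈_ to _∈ₛ_)
open import Data.Fin.Subset.Properties using (p⊂q⇒∣p∣<∣q∣; ∣p∣≤n)
open import Data.List using (List; []; _∷_; allFin; filter; length)
open import Data.List.Membership.Propositional using (_∈_)
open import Data.List.Membership.Propositional.Properties
  using (∈-allFin; ∈-filter⁺; ∈-filter⁻)
open import Data.List.Relation.Unary.Any using (here; satisfied)
import Data.List.Relation.Unary.Any as Any
import Data.List.Relation.Unary.All as All
open import Data.List.Relation.Unary.All.Properties using (all⁺; all⁻)
open import Data.List.Relation.Unary.Any.Properties using (any⁺; any⁻)
open import Data.Nat using (ℕ; zero; suc; _≤_; _<_; _∸_; z≤n; s≤s)
open import Data.Nat.Induction using (<-wellFounded)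
open import Data.Nat.Properties
  using ( ≤-reflexive; ≤-antisym; <⇒≤; <⇒≢; <⇒≱; 1+n≰n; m≤n⇒m≤1+n; n<1+n
        ; ∸-monoʳ-<; ≡ᵇ⇒≡; ≡⇒≡ᵇ)
open import Data.Product using (Σ; _×_; _,_; proj₁; proj₂)
open import Data.Vec using (tabulate; _∷_; [])
open import Data.Vec.Properties using (lookup∘tabulate; lookup⇒[]=; []=⇒lookup)
open import Function.Base using (case_of_)
open import Function.Bundles using (Equivalence)
open import Induction.WellFounded using (Acc; acc)
open import Relation.Binary.PropositionalEquality
  using (_≡_; refl; sym; trans; subst; cong)
open import Relation.Nullary using (¬_)
open import Relation.Unary using (Decidable)

open Equivalence using (to; from)

true≢false : ∀ {b} → b ≡ true → b ≡ false → ⊥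
true≢false refl ()

∧-intro : ∀ {a b} → a ≡ true → b ≡ true → a ∧ b ≡ true
∧-intro refl refl = refl

∧-elimˡ : ∀ {a b} → a ∧ b ≡ true → a ≡ true
∧-elimˡ {a} {b} = ∧-conicalˡ a b

∧-elimʳ : ∀ {a b} → a ∧ b ≡ true → b ≡ true
∧-elimʳ {a} {b} = ∧-conicalʳ a b

not-true : ∀ {a} → not a ≡ true → a ≡ false
not-true {false} refl = refl

not-false : ∀ {a} → not a ≡ false → a ≡ true
not-false {true} refl = refl

⇒ᵇ-elim : ∀ a b c → ((a ∧ b) ⇒ᵇ c) ≡ true → a ≡ true → b ≡ true → c ≡ true
⇒ᵇ-elim true true c e refl refl = e

⇒ᵇ-intro : ∀ a b c → (a ≡ true → b ≡ true → c ≡ true) → ((a ∧ b) ⇒ᵇ c) ≡ true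
⇒ᵇ-intro true  true  c h = h refl refl
⇒ᵇ-intro true  false c h = refl
⇒ᵇ-intro false b     c h = refl

⇒ᵇ-refute : ∀ a b c → ¬ (((a ∧ b) ⇒ᵇ c) ≡ true) → a ≡ true × b ≡ true × c ≡ false
⇒ᵇ-refute true  true  false h = refl , refl , refl
⇒ᵇ-refute true  true  true  h = ⊥-elim (h refl)
⇒ᵇ-refute true  false c     h = ⊥-elim (h refl)
⇒ᵇ-refute false b     c     h = ⊥-elim (h refl)

allV-sound : ∀ {m} (p : Fin m → Bool) → allV p ≡ true → ∀ v → p v ≡ true
allV-sound {m} p e v =
  to T-≡ (All.lookup (all⁺ p (allFin m) (from T-≡ e)) (∈-allFin v))

allV-complete : ∀ {m} (p : Fin m → Bool) → (∀ v → p v ≡ true) → allV p ≡ true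
allV-complete {m} p h =
  to T-≡ (all⁻ p (All.tabulate {xs = allFin m} (λ {v} _ → from T-≡ (h v))))

anyV-sound : ∀ {m} (p : Fin m → Bool) → anyV p ≡ true → Σ (Fin m) (λ v → p v ≡ true)
anyV-sound {m} p e with satisfied (any⁻ p (allFin m) (from T-≡ e))
... | v , pv = v , to T-≡ pv

anyV-refute : ∀ {m} (p : Fin m → Bool) → anyV p ≡ false → ∀ v → p v ≡ false
anyV-refute p e v = ¬-not λ pv →
  true≢false (to T-≡ (any⁺ p (Any.map (λ { refl → from T-≡ pv }) (∈-allFin v)))) e

module Domination (G : Graph) where

  V : Set
  V = Fin (n G)

  adj-flip : ∀ {u v} → adj G u v ≡ true → adj G v u ≡ true
  adj-flip {u} {v} e = trans (adj-sym G v u) e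

  Dominated : VSet (n G) → V → V → Set
  Dominated S v w = ∀ u → S u ≡ true → adj G u v ≡ true → adj G u w ≡ true

  dominated-refl : ∀ {S v} → Dominated S v v
  dominated-refl u _ a = a

  dominated-trans : ∀ {S a b c} → Dominated S a b → Dominated S b c → Dominated S a c
  dominated-trans ab bc u su a = bc u su (ab u su a)

  record StrictlyDominated (S : VSet (n G)) (v w : V) : Set where
    field
      v∈S : S v ≡ true
      w∈S : S w ≡ true
      v⊑w : Dominated S v w
      w⋢v : ¬ Dominated S w v
  open StrictlyDominated public

  strict-then-dominated : ∀ {S v w t} → StrictlyDominated S v w → Dominated S w t →
                          S t ≡ true → StrictlyDominated S v t
  strict-then-dominated sd w⊑t st = record
    { v∈S = v∈S sd ; w∈S = st ; v⊑w = dominated-trans (v⊑w sd) w⊑t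
    ; w⋢v = λ t⊑v → w⋢v sd (dominated-trans w⊑t t⊑v) }

  nbhdSub-sound : ∀ {S v w} → nbhdSub G S v w ≡ true → Dominated S v w
  nbhdSub-sound {S} {v} {w} e u su a =
    ⇒ᵇ-elim (S u) (adj G u v) (adj G u w) (allV-sound _ e u) su a

  nbhdSub-complete : ∀ {S v w} → Dominated S v w → nbhdSub G S v w ≡ true
  nbhdSub-complete {S} {v} {w} d =
    allV-complete _ (λ u → ⇒ᵇ-intro (S u) (adj G u v) (adj G u w) (d u))

  undominated-witness : ∀ {S v w} → ¬ Dominated S v w →
    Σ V (λ q → S q ≡ true × adj G q v ≡ true × adj G q w ≡ false)
  undominated-witness {S} {v} {w} ¬d with
    ¬∀⟶∃¬ (n G) (λ q → ((S q ∧ adj G q v) ⇒ᵇ adj G q w) ≡ true) (λ q → _ ≟ᵇ true)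
          (λ h → ¬d (λ u → ⇒ᵇ-elim (S u) (adj G u v) (adj G u w) (h u)))
  ... | q , ¬pq = q , ⇒ᵇ-refute (S q) (adj G q v) (adj G q w) ¬pq

  strict-corner-sound : ∀ {S v} → isStrictCorner G S v ≡ true → Σ V (StrictlyDominated S v)
  strict-corner-sound {S} {v} e with anyV-sound _ e
  ... | w , c = w , record
    { v∈S = ∧-elimˡ c
    ; w∈S = ∧-elimˡ (∧-elimʳ {S v} c)
    ; v⊑w = nbhdSub-sound (∧-elimˡ (∧-elimʳ {S w} (∧-elimʳ {S v} c)))
    ; w⋢v = λ d → true≢false (nbhdSub-complete d)
                    (not-true (∧-elimʳ {nbhdSub G S v w} (∧-elimʳ {S w} (∧-elimʳ {S v} c)))) }

  non-corner-maximal : ∀ {S v w} → isStrictCorner G S v ≡ false → S v ≡ true → S w ≡ true →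
                       Dominated S v w → Dominated S w v
  non-corner-maximal {S} {v} {w} e sv sw d = nbhdSub-sound (not-false notCornered)
    where
    notCornered : not (nbhdSub G S w v) ≡ false
    notCornered with anyV-refute _ e w
    ... | c rewrite sv | sw | nbhdSub-complete d = c

  -- One round of corner deletion: the vertex set of the next graph.  It is
  -- kept opaque (iterating it blows up normal forms) and used through the
  -- four lemmas below.
  opaque
    survivors : VSet (n G) → VSet (n G)
    survivors S u = S u ∧ not (isStrictCorner G S u)

    survivor-member : ∀ {S v} → survivors S v ≡ true → S v ≡ true
    survivor-member = ∧-elimˡ

    survivor-non-corner : ∀ {S v} → survivors S v ≡ true → isStrictCorner G S v ≡ false
    survivor-non-corner {S} {v} e = not-true (∧-elimʳ {S v} e)

    survives : ∀ {S v} → S v ≡ true → isStrictCorner G S v ≡ false → survivors S v ≡ true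
    survives sv c rewrite c = ∧-intro sv refl

    removed-corner : ∀ {S v} → S v ≡ true → survivors S v ≡ false → isStrictCorner G S v ≡ true
    removed-corner {S} {v} sv e rewrite sv = not-false e

    corner-removed : ∀ {S v} → isStrictCorner G S v ≡ true → survivors S v ≡ false
    corner-removed {S} {v} c rewrite c = ∧-zeroʳ (S v)

  dominated-survivors : ∀ {S v w} → Dominated S v w → Dominated (survivors S) v w
  dominated-survivors d u su = d u (survivor-member su)

  nbhd : VSet (n G) → V → Subset (n G)
  nbhd S w = tabulate (λ u → S u ∧ adj G u w)

  ∈-nbhd⁺ : ∀ {S u w} → S u ≡ true → adj G u w ≡ true → u ∈ₛ nbhd S w
  ∈-nbhd⁺ {S} {u} {w} su a =
    lookup⇒[]= u (nbhd S w) (trans (lookup∘tabulate _ u) (∧-intro su a))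

  ∈-nbhd⁻ : ∀ {S u w} → u ∈ₛ nbhd S w → S u ≡ true × adj G u w ≡ true
  ∈-nbhd⁻ {S} {u} {w} m with trans (sym (lookup∘tabulate (λ x → S x ∧ adj G x w) u)) ([]=⇒lookup m)
  ... | c = ∧-elimˡ c , ∧-elimʳ {S u} c

  -- Strict domination strictly enlarges the closed neighbourhood, so the
  -- number of vertices missing from it strictly drops.
  nbhd-grows : ∀ {S v w} → StrictlyDominated S v w → nbhd S v ⊂ nbhd S w
  nbhd-grows {S} {v} {w} sd with undominated-witness (w⋢v sd)
  ... | q , sq , aqw , aqv =
    (λ m → let su , a = ∈-nbhd⁻ m in ∈-nbhd⁺ su (v⊑w sd _ su a)) ,
    q , ∈-nbhd⁺ sq aqw , λ m → true≢false (proj₂ (∈-nbhd⁻ m)) aqv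

  deficiency : VSet (n G) → V → ℕ
  deficiency S w = n G ∸ ∣ nbhd S w ∣

  deficiency-drops : ∀ {S v w} → StrictlyDominated S v w → deficiency S w < deficiency S v
  deficiency-drops {S} {v} {w} sd = ∸-monoʳ-< (p⊂q⇒∣p∣<∣q∣ (nbhd-grows sd)) (∣p∣≤n (nbhd S w))

  dominating-survivor : ∀ {S y} → S y ≡ true → Σ V (λ t → survivors S t ≡ true × Dominated S y t)
  dominating-survivor {S} {y} sy = climb (<-wellFounded (deficiency S y)) sy
    where
    climb : ∀ {y} → Acc _<_ (deficiency S y) → S y ≡ true →
            Σ V (λ t → survivors S t ≡ true × Dominated S y t)
    climb {y} (acc smaller) sy with isStrictCorner G S y in corner
    ... | false = y , survives sy corner , dominated-refl
    ... | true with strict-corner-sound corner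
    ... | w , sd with climb (smaller (deficiency-drops sd)) (w∈S sd)
    ... | t , st , w⊑t = t , st , dominated-trans (v⊑w sd) w⊑t

  removed-neighbour : ∀ {S v w} → StrictlyDominated (survivors S) v w →
    Σ V (λ q → S q ≡ true × survivors S q ≡ false × adj G q v ≡ true × adj G q w ≡ false)
  removed-neighbour {S} {v} {w} sd with undominated-witness ¬v⊑w
    where
    ¬v⊑w : ¬ Dominated S v w
    ¬v⊑w d = w⋢v sd (dominated-survivors
      (non-corner-maximal (survivor-non-corner (v∈S sd)) (survivor-member (v∈S sd))
                          (survivor-member (w∈S sd)) d))
  ... | q , sq , aqv , aqw with survivors S q in surv
  ... | true  = ⊥-elim (true≢false (v⊑w sd q surv aqv) aqw)
  ... | false = q , sq , surv , aqv , aqw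

module FourLayers (G : Graph) (S₀ : VSet (n G)) where
  open Domination G

  S₁ S₂ S₃ : VSet (n G)
  S₁ = survivors S₀
  S₂ = survivors S₁
  S₃ = survivors S₂

  Removed₃ : V → Set
  Removed₃ v = S₂ v ≡ true × S₃ v ≡ false

  module _ (x : V) (x∈S₀ : S₀ x ≡ true) (x-removed : S₁ x ≡ false)
           (only-x : ∀ v → S₀ v ≡ true → S₁ v ≡ false → v ≡ x)
           (S₃-subsingleton : ∀ a b → S₃ a ≡ true → S₃ b ≡ true → a ≡ b) where

    second-round-sees-x : ∀ {y} → S₁ y ≡ true → S₂ y ≡ false → adj G x y ≡ true
    second-round-sees-x s₁y s₂y with strict-corner-sound (removed-corner s₁y s₂y)
    ... | w , sd with removed-neighbour sd
    ... | q , s₀q , s₁q , aqy , _ = subst (λ z → adj G z _ ≡ true) (only-x q s₀q s₁q) aqy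

    -- It is a survivor dominating a vertex w that corners x
    -- (w survives the first round: otherwise w = x would strictly dominate x).
    hub : Σ V (λ u → S₂ u ≡ true × (∀ y → S₁ y ≡ true → S₂ y ≡ false → adj G y u ≡ true))
    hub with strict-corner-sound (removed-corner x∈S₀ x-removed)
    ... | w , sd with S₁ w in s₁w
    ... | false = ⊥-elim (w⋢v sd (subst (λ z → Dominated S₀ z x)
                                         (sym (only-x w (w∈S sd) s₁w)) dominated-refl))
    ... | true with dominating-survivor s₁w
    ... | u , s₂u , w⊑u = u , s₂u , λ y s₁y s₂y →
      w⊑u y s₁y (v⊑w sd y (survivor-member s₁y) (adj-flip (second-round-sees-x s₁y s₂y)))

    opaque
      u : V
      u = proj₁ hub

      hub∈S₂ : S₂ u ≡ true
      hub∈S₂ = proj₁ (proj₂ hub)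

      hub-sees : ∀ {y} → S₁ y ≡ true → S₂ y ≡ false → adj G y u ≡ true
      hub-sees s₁y s₂y = proj₂ (proj₂ hub) _ s₁y s₂y

    avoids-S₃ : ∀ {y z t'} → S₃ t' ≡ true → adj G y t' ≡ false → adj G y z ≡ true → S₃ z ≡ false
    avoids-S₃ {y} s₃t' ayt' ayz = ¬-not λ s₃z →
      true≢false (subst (λ c → adj G y c ≡ true) (S₃-subsingleton _ _ s₃z s₃t') ayz) ayt'

    -- (3a) A vertex b removed in the third round sees a vertex y removed in
    -- the second round that misses a vertex of S₃: b is strictly dominated in
    -- G[S₂] by some vertex of S₃, and y witnesses it one layer down.  (Opaque:
    -- only the statement matters, and unfolding the proof term is costly.)
    opaque
      sees-second-round : ∀ {b} → Removed₃ b →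
        Σ V (λ y → S₁ y ≡ true × S₂ y ≡ false × adj G y b ≡ true ×
                   Σ V (λ t' → S₃ t' ≡ true × adj G y t' ≡ false))
      sees-second-round (s₂b , s₃b) =
        let w , sd          = strict-corner-sound (removed-corner s₂b s₃b)
            t' , s₃t' , w⊑t' = dominating-survivor (w∈S sd)
            sd'             = strict-then-dominated sd w⊑t' (survivor-member s₃t')
            y , s₁y , s₂y , ayb , ayt' = removed-neighbour sd'
        in y , s₁y , s₂y , ayb , t' , s₃t' , ayt'

    -- (3b) Such a y is dominated in G[S₁] by a survivor t, which then sees
    -- both b and the hub; neither t nor the hub lies in S₃, since y sees them.
    through-second-round : ∀ {b y t'} → S₂ b ≡ true → S₁ y ≡ true → S₂ y ≡ false →
      adj G y b ≡ true → S₃ t' ≡ true → adj G y t' ≡ false →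
      Σ V (λ t → Removed₃ t × adj G b t ≡ true × adj G t u ≡ true) × Removed₃ u
    through-second-round {b} {y} s₂b s₁y s₂y ayb s₃t' ayt' with dominating-survivor s₁y
    ... | t , s₂t , y⊑t =
      (t , (s₂t , avoids-S₃ s₃t' ayt' ayt) , abt , adj-flip aut) ,
      (hub∈S₂ , avoids-S₃ s₃t' ayt' ayu)
      where
      ayt : adj G y t ≡ true
      ayt = y⊑t y s₁y (adj-refl G y)
      ayu : adj G y u ≡ true
      ayu = hub-sees s₁y s₂y
      aut : adj G u t ≡ true
      aut = y⊑t u (survivor-member hub∈S₂) (adj-flip ayu)
      abt : adj G b t ≡ true
      abt = y⊑t b (survivor-member s₂b) (adj-flip ayb)

    meets-hub : ∀ {b} → Removed₃ b →
      Σ V (λ t → Removed₃ t × adj G b t ≡ true × adj G t u ≡ true) × Removed₃ u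
    meets-hub rb@(s₂b , _) with sees-second-round rb
    ... | y , s₁y , s₂y , ayb , t' , s₃t' , ayt' = through-second-round s₂b s₁y s₂y ayb s₃t' ayt'

    removed₃-connected : InducedConnected G Removed₃
    removed₃-connected a b ra rb with meets-hub ra | meets-hub rb
    ... | (ta , rta , a~ta , ta~u) , ru | (tb , rtb , b~tb , tb~u) , _ =
      step ra a~ta (step rta ta~u (step ru (adj-flip tb~u) (step rtb (adj-flip b~tb) (here rb))))

walk-map : ∀ {G : Graph} {P Q : Fin (n G) → Set} {a b} →
           (∀ {v} → P v → Q v) → Walk G P a b → Walk G Q a b
walk-map f (here pa)        = here (f pa)
walk-map f (step pa e rest) = step (f pa) e (walk-map f rest)

length-one : ∀ {A : Set} (xs : List A) → length xs ≡ 1 → Σ A (λ c → xs ≡ c ∷ [])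
length-one (c ∷ []) refl = c , refl

fin-injective : ∀ {a b} → fin a ≡ fin b → a ≡ b
fin-injective refl = refl

module Ranking (G : Graph) where
  open Domination G

  -- layer j is the vertex set of G^(j+1) as long as the procedure runs.
  layer : ℕ → VSet (n G)
  layer zero    = λ _ → true
  layer (suc j) = survivors (layer j)

  rankGo-lower : ∀ f k S v {r} → rankGo G f k S v ≡ fin r → k ≤ r
  rankGo-lower zero    k S v ()
  rankGo-lower (suc f) k S v e with isClique G S | hasStrictCorner G S | isStrictCorner G S v
  ... | true  | _     | _     = ≤-reflexive (fin-injective e)
  ... | false | false | _     = case e of λ ()
  ... | false | true  | true  = ≤-reflexive (fin-injective e)
  ... | false | true  | false = <⇒≤ (rankGo-lower f (suc k) _ v e)

  round-continues : ∀ {f k S z r} → rankGo G f k S z ≡ fin r → k < r →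
    Σ ℕ (λ f' → f ≡ suc f' × isClique G S ≡ false × hasStrictCorner G S ≡ true)
  round-continues {zero} ()
  round-continues {suc f} {k} {S} {z} e k<r
    with isClique G S | hasStrictCorner G S | isStrictCorner G S z
  ... | true  | _     | _     = ⊥-elim (<⇒≢ k<r (fin-injective e))
  ... | false | false | _     = case e of λ ()
  ... | false | true  | true  = ⊥-elim (<⇒≢ k<r (fin-injective e))
  ... | false | true  | false = f , refl , refl , refl

  corner-round : ∀ {f k S v} → isClique G S ≡ false → hasStrictCorner G S ≡ true →
                 isStrictCorner G S v ≡ true → rankGo G (suc f) k S v ≡ fin k
  corner-round c h sc rewrite c | h | sc = refl

  opaque
    unfolding survivors
    survivor-round : ∀ {f k S v} → isClique G S ≡ false → hasStrictCorner G S ≡ true →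
                     isStrictCorner G S v ≡ false →
                     rankGo G (suc f) k S v ≡ rankGo G f (suc k) (survivors S) v
    survivor-round c h sc rewrite c | h | sc = refl

  record Stage (j : ℕ) : Set where
    field
      fuel          : ℕ
      ranked        : ∀ v → layer j v ≡ true → rank G v ≡ rankGo G fuel (suc j) (layer j) v
      removed-below : ∀ v {s} → layer j v ≡ false → rank G v ≡ fin s → s ≤ j
  open Stage

  stage-zero : Stage 0
  stage-zero = record { fuel = suc (n G) ; ranked = λ v _ → refl ; removed-below = λ v () }

  -- If some vertex z has finite rank r, the rounds before round r are not
  -- the last ones, and ranks below r are read off the layers.
  module Outlived (z : V) {r : ℕ} (rank-z : rank G z ≡ fin r) where

    record Round (j : ℕ) : Set where
      field
        corners-ranked : ∀ v → layer j v ≡ true → isStrictCorner G (layer j) v ≡ true →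
                         rank G v ≡ fin (suc j)
        next-stage     : Stage (suc j)
    open Round

    round : ∀ {j} → suc j < r → Stage j → Round j
    round {j} j+1<r st with layer j z in z∈layer
    ... | false = ⊥-elim (<⇒≱ (<⇒≤ j+1<r) (removed-below st z z∈layer rank-z))
    ... | true with round-continues {fuel st} {suc j} {layer j} {z}
                      (trans (sym (ranked st z z∈layer)) rank-z) j+1<r
    ... | f' , fuel≡ , not-clique , has-corner = record
      { corners-ranked = corners
      ; next-stage     = record { fuel          = f'
                                ; ranked        = survivors-ranked
                                ; removed-below = removed-ranked } }
      where
      ranked' : ∀ v → layer j v ≡ true → rank G v ≡ rankGo G (suc f') (suc j) (layer j) v
      ranked' v lv = subst (λ f → rank G v ≡ rankGo G f (suc j) (layer j) v) fuel≡ (ranked st v lv)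

      corners : ∀ v → layer j v ≡ true → isStrictCorner G (layer j) v ≡ true →
                rank G v ≡ fin (suc j)
      corners v lv c =
        trans (ranked' v lv) (corner-round {f'} {suc j} {layer j} not-clique has-corner c)

      survivors-ranked : ∀ v → layer (suc j) v ≡ true →
                         rank G v ≡ rankGo G f' (suc (suc j)) (layer (suc j)) v
      survivors-ranked v lv = trans (ranked' v (survivor-member lv))
                                    (survivor-round {f'} {suc j} {layer j} not-clique has-corner
                                                   (survivor-non-corner lv))

      removed-ranked : ∀ v {s} → layer (suc j) v ≡ false → rank G v ≡ fin s → s ≤ suc j
      removed-ranked v e rv with layer j v in lv
      ... | false = m≤n⇒m≤1+n (removed-below st v lv rv)
      ... | true  =
        ≤-reflexive (fin-injective (trans (sym rv) (corners v lv (removed-corner lv e))))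

    stage : ∀ j → j < r → Stage j
    stage zero    _     = stage-zero
    stage (suc j) j+1<r = next-stage (round j+1<r (stage j (<⇒≤ j+1<r)))

    survivor-rank : ∀ {j v s} → j < r → layer j v ≡ true → rank G v ≡ fin s → suc j ≤ s
    survivor-rank {j} {v} j<r lv rv =
      rankGo-lower (fuel st) (suc j) (layer j) v (trans (sym (ranked st v lv)) rv)
      where
      st : Stage j
      st = stage j j<r

    corner-rank : ∀ {j v} → suc j < r → layer j v ≡ true →
                  isStrictCorner G (layer j) v ≡ true → rank G v ≡ fin (suc j)
    corner-rank {j} j+1<r = corners-ranked (round j+1<r (stage j (<⇒≤ j+1<r))) _

    rank-corner : ∀ {j v} → suc j < r → rank G v ≡ fin (suc j) →
                  layer j v ≡ true × isStrictCorner G (layer j) v ≡ true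
    rank-corner {j} {v} j+1<r rv = in-layer , corner
      where
      in-layer : layer j v ≡ true
      in-layer = ¬-not λ lv → 1+n≰n (removed-below (stage j (<⇒≤ j+1<r)) v lv rv)
      corner : isStrictCorner G (layer j) v ≡ true
      corner = ¬-not λ c → 1+n≰n (survivor-rank j+1<r (survives in-layer c) rv)

  hasRank-complete : ∀ {r v} → rank G v ≡ fin r → hasRank G r v ≡ true
  hasRank-complete {r} {v} e with rank G v
  hasRank-complete {r} refl | .(fin r) = to T-≡ (≡⇒≡ᵇ r r refl)

  hasRank-sound : ∀ {r v} → hasRank G r v ≡ true → rank G v ≡ fin r
  hasRank-sound {r} {v} e with rank G v
  ... | fin s = cong fin (sym (≡ᵇ⇒≡ r s (from T-≡ e)))
  ... | ∞     = case e of λ ()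

  has-rank? : ∀ r → Decidable (λ v → hasRank G r v ≡ true)
  has-rank? r v = hasRank G r v ≟ᵇ true

  sole-vertex-of-rank : ∀ {r} → rankCount G r ≡ 1 →
    Σ V (λ c → rank G c ≡ fin r × (∀ v → rank G v ≡ fin r → v ≡ c))
  sole-vertex-of-rank {r} one with length-one (filter (has-rank? r) (allFin (n G))) one
  ... | c , only = c , c-has-r , λ v rv →
    singleton (subst (v ∈_) only (∈-filter⁺ (has-rank? r) (∈-allFin v) (hasRank-complete rv)))
    where
    c-has-r : rank G c ≡ fin r
    c-has-r = hasRank-sound (proj₂ (∈-filter⁻ (has-rank? r) {xs = allFin (n G)}
                                              (subst (c ∈_) (sym only) (here refl))))
    singleton : ∀ {v} → v ∈ c ∷ [] → v ≡ c
    singleton (here e) = e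

module RealizesOneMKOne (G : Graph) (cr : CornerRank G 4)
                        (single₄ : rankCount G 4 ≡ 1) (single₁ : rankCount G 1 ≡ 1) where
  open Domination G
  open Ranking G
  open Outlived (proj₁ (proj₂ cr)) (proj₂ (proj₂ cr))

  1<4 : 1 < 4
  1<4 = s≤s (s≤s z≤n)

  3<4 : 3 < 4
  3<4 = n<1+n 3

  x : V
  x = proj₁ (sole-vertex-of-rank single₁)

  rank-x : rank G x ≡ fin 1
  rank-x = proj₁ (proj₂ (sole-vertex-of-rank single₁))

  rank-1-is-x : ∀ v → rank G v ≡ fin 1 → v ≡ x
  rank-1-is-x = proj₂ (proj₂ (sole-vertex-of-rank single₁))

  top : V
  top = proj₁ (sole-vertex-of-rank single₄)

  rank-4-is-top : ∀ v → rank G v ≡ fin 4 → v ≡ top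
  rank-4-is-top = proj₂ (proj₂ (sole-vertex-of-rank single₄))

  x-removed-first : layer 1 x ≡ false
  x-removed-first = corner-removed (proj₂ (rank-corner {0} 1<4 rank-x))

  only-x-removed-first : ∀ v → layer 0 v ≡ true → layer 1 v ≡ false → v ≡ x
  only-x-removed-first v l₀ l₁ = rank-1-is-x v (corner-rank {0} 1<4 l₀ (removed-corner l₀ l₁))

  -- A vertex of layer 3 has rank ≥ 4, and the corner rank is 4.
  layer₃-is-top : ∀ {v} → layer 3 v ≡ true → v ≡ top
  layer₃-is-top {v} l₃ with proj₁ cr v
  ... | s , rv , s≤4 =
    rank-4-is-top v (trans rv (cong fin (≤-antisym s≤4 (survivor-rank 3<4 l₃ rv))))

  layer₃-subsingleton : ∀ a b → layer 3 a ≡ true → layer 3 b ≡ true → a ≡ b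
  layer₃-subsingleton a b l₃a l₃b = trans (layer₃-is-top l₃a) (sym (layer₃-is-top l₃b))

  removed₃⇒rank-3 : ∀ {v} → layer 2 v ≡ true × layer 3 v ≡ false → rank G v ≡ fin 3
  removed₃⇒rank-3 (l₂ , l₃) = corner-rank {2} 3<4 l₂ (removed-corner l₂ l₃)

  rank-3⇒removed₃ : ∀ {v} → rank G v ≡ fin 3 → layer 2 v ≡ true × layer 3 v ≡ false
  rank-3⇒removed₃ rv with rank-corner {2} 3<4 rv
  ... | l₂ , corner = l₂ , corner-removed corner

theorem3p24 : (m k : ℕ) → 1 ≤ m → 1 ≤ k → (G : Graph) →
    Realizes G (1 ∷ m ∷ k ∷ 1 ∷ []) →
    InducedConnected G (λ v → rank G v ≡ fin 3)
theorem3p24 m k _ _ G (cr , counts) a b ra rb =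
  walk-map removed₃⇒rank-3
    (removed₃-connected x refl x-removed-first only-x-removed-first layer₃-subsingleton
                        a b (rank-3⇒removed₃ ra) (rank-3⇒removed₃ rb))
  where
  open RealizesOneMKOne G cr (counts zero) (counts (suc (suc (suc zero))))
  open Ranking G using (layer)
  open FourLayers G (layer 0)
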